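{- Let $N$ be a finite BSR(SLI) clause set in normal form such that, if the constant symbol $c_{ -\infty}$ occurs in $N$, then $\Psi^{ -\infty}_N\subseteq N$. Suppose some clause $C\in N$ contains a base-sort variable $x$, and let $\hat N_x := (N\setminus\{C\}) \cup \{C\{x/c\} : c\in\mathcal{I}_{\downarrow_N(x)}\} \cup \Psi^{ -\infty}_N$. Then $N$ is satisfiable if and only if $\hat N_x$ is satisfiable.
   Context: Setting: base sort $\mathcal{Z}$ interpreted as $\mathbb{Z}$, free sort $\mathcal{S}$. BSR(SLI) clauses $\Lambda\,\|\,\Gamma\to\Delta$: $\Lambda$ is a multiset of LIA constraints $s\triangleleft t$, $x\triangleleft t$, $x\trianglelefteq y$ ($s,t$ ground LIA terms built from integers, $+,-$ and base-sort Skolem constants; $x,y$ base-sort variables; $\triangleleft\in\{<,\le,=,\neq,\ge,>\}$, $\trianglelefteq\in\{\le,=,\ge\}$); $\Gamma,\Delta$ are multisets of free-sort equations $s\approx s'$ between free-sort variables or free-sort constants, or atoms $P(s_1,\dots,s_m)$ of uninterpreted sorted predicates whose base-sort arguments are variables and free-sort arguments are variables or free-sort constants; the clause means $(\bigwedge\Lambda\wedge\bigwedge\Gamma)\to\bigvee\Delta$, universally closed. Satisfiability is w.r.t. hierarchic interpretations (base sort is $\mathbb{Z}$ with standard arithmetic, Skolem constants get integer values, free sort a nonempty set, predicates and free constants interpreted freely). Normal form of a clause set: every non-ground atom of $\Lambda$ is $x\trianglelefteq c$ ($c$ an integer or Skolem constant, $\trianglelefteq\in\{\le,=,\ge\}$)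 or $x\le y$ (or symmetric variants); base-sort variables of $\Lambda$ occur in $\Gamma\to\Delta$; $\Gamma$ contains no $u\approx t$ with $u$ a free-sort variable; clauses pairwise variable-disjoint; at least one free-sort constant occurs. $\sqsubseteq_N$ is the smallest reflexive, transitive relation on argument positions $\langle P,i\rangle$ with $\langle Q,j\rangle\sqsubseteq_N\langle P,i\rangle$ whenever some clause of $N$ contains $Q(\dots,u,\dots)$ ($u$ at position $j$) and $P(\dots,v,\dots)$ ($v$ at position $i$) with $u=v$, or with $u\neq v$ base-sort and $u=v$ or $u\le v$ in $\Lambda$, or with $u\ne v$ free-sort and $u\approx v$ in $\Gamma$ or $\Delta$ (free-sort variables $v$ occurring only in equations are treated as if $\Delta$ contained $\mathit{False}_v(v)$ for a fresh predicate $\mathit{False}_v$). $\downarrow_N\langle P,i\rangle := \{\langle Q,j\rangle:\langle Q,j\rangle\sqsubseteq_N\langle P,i\rangle\}$; for a variable $v$ occurring as $i$-th argument of an atom $P(\dots)$ in $N$, $\downarrow_N(v):=\downarrow_N\langle P,i\rangle$. For a base-sort position, $\mathcal{I}_{P,i}$ is the set of constant symbols $d$ (integers or Skolem constants) such that some clause of $N$ contains an atom $P(\dots,x,\dots)$ with $x$ as $i$-th argument and a constraint $x=d$ or $x\ge d$; $\mathcal{I}_{\downarrow_N\langle P,i\rangle} := \{c_{ -\infty}\}\cup\bigcup_{\langle Q,j\rangle\in\downarrow_N\langle P,i\rangle}\mathcal{I}_{Q,j}$, where $c_{ -\infty}$ is a distinguished base-sort constant symbol. $\Psi^{ -\infty}_N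 := \{(c_{ -\infty}\ge c \,\|\, \to \Box) : c \text{ a base-sort constant symbol occurring in } N,\ c\ne c_{ -\infty}\}$ (i.e. the axioms $c_{ -\infty}<c$), where $\Box$ denotes the empty disjunction. For a base-sort variable $x$ and base-sort constant $c$, $(\Lambda\,\|\,\Gamma\to\Delta)\{x/c\} := \Lambda\{x/c\}, x=c \,\|\, \Gamma\to\Delta$, i.e. the constraint $x=c$ is added (with $x$ replaced by $c$ in $\Lambda$, the free part unchanged). -}

module Defs where

open import Data.Nat as ℕ using (ℕ; zero; suc)
open import Data.Integer as ℤ using (ℤ)
open import Data.Bool using (Bool; true; false; if_then_else_)
open import Data.List using (List; []; _∷_; _++_; map; lookup; length)
open import Data.List.Relation.Unary.All as All using (All; []; _∷_)
open import Data.List.Relation.Unary.Any using (Any)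
open import Data.List.Membership.Propositional using (_∈_)
open import Data.Fin using (Fin)
open import Data.Product using (Σ; ∃; ∃-syntax; _×_; _,_)
open import Data.Sum using (_⊎_)
open import Data.Unit using (⊤)
open import Relation.Nullary using (¬_; does)
open import Relation.Binary.PropositionalEquality using (_≡_; _≢_)

data Sort : Set where
  base free : Sort

data BConst : Set where
  num : ℤ → BConst
  sk  : ℕ → BConst
  c-∞ : BConst

data GTerm : Set where
  con     : BConst → GTerm
  _⊕_ _⊖_ : GTerm → GTerm → GTerm

data Rel : Set where
  lt le eq ne ge gt : Rel

data Constr : Set where
  gnd : GTerm → Rel → GTerm → Constr
  vt  : ℕ → Rel → GTerm → Constr
  vv  : ℕ → Rel → ℕ → Constr

data FTerm : Set where
  fvar fcon : ℕ → FTerm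

-- the syntactic argument allowed at a position of a given sort:
-- base-sort positions hold base-sort variables, free-sort positions hold
-- free-sort variables or constants
ArgOf : Sort → Set
ArgOf base = ℕ
ArgOf free = FTerm

record PSym : Set where
  constructor psym
  field
    name  : ℕ
    sorts : List Sort
open PSym public

data Atom : Set where
  _≈ₐ_ : FTerm → FTerm → Atom
  app  : (P : PSym) → All ArgOf (sorts P) → Atom

record Clause : Set where
  constructor _∥_⇒_
  field
    Λ : List Constr
    Γ : List Atom
    Δ : List Atom
open Clause public

Atoms : Clause → List Atom
Atoms D = Γ D ++ Δ D

-- ArgAt as i s a : the i-th (0-based) argument is a (of sort s)
data ArgAt : {ss : List Sort} → All ArgOf ss → ℕ → (s : Sort) → ArgOf s → Set where
  here  : ∀ {s ss} {a : ArgOf s} {as : All ArgOf ss} →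
          ArgAt (a ∷ as) zero s a
  there : ∀ {s' ss} {a' : ArgOf s'} {as : All ArgOf ss} {i s} {a : ArgOf s} →
          ArgAt as i s a → ArgAt (a' ∷ as) (suc i) s a

Pos : Set
Pos = PSym × ℕ

OccAt : Clause → Pos → (s : Sort) → ArgOf s → Set
OccAt D (P , i) s u = ∃[ args ] (app P args ∈ Atoms D × ArgAt args i s u)

data BVarIn (x : ℕ) : Constr → Set where
  vt-x : ∀ {r t} → BVarIn x (vt x r t)
  vv-l : ∀ {r y} → BVarIn x (vv x r y)
  vv-r : ∀ {r y} → BVarIn x (vv y r x)

BVarInAtoms : Clause → ℕ → Set
BVarInAtoms D x = ∃[ p ] OccAt D p base x

BVarOf : Clause → ℕ → Set
BVarOf D x = Any (BVarIn x) (Λ D) ⊎ BVarInAtoms D x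

data FTermInAtom (t : FTerm) : Atom → Set where
  eq-l : ∀ {s} → FTermInAtom t (t ≈ₐ s)
  eq-r : ∀ {s} → FTermInAtom t (s ≈ₐ t)
  arg  : ∀ {P args i} → ArgAt args i free t → FTermInAtom t (app P args)

FVarOf : Clause → ℕ → Set
FVarOf D u = Any (FTermInAtom (fvar u)) (Atoms D)

data BConstInTerm (c : BConst) : GTerm → Set where
  here : BConstInTerm c (con c)
  ⊕ˡ : ∀ {s t} → BConstInTerm c s → BConstInTerm c (s ⊕ t)
  ⊕ʳ : ∀ {s t} → BConstInTerm c t → BConstInTerm c (s ⊕ t)
  ⊖ˡ : ∀ {s t} → BConstInTerm c s → BConstInTerm c (s ⊖ t)
  ⊖ʳ : ∀ {s t} → BConstInTerm c t → BConstInTerm c (s ⊖ t)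

data BConstInConstr (c : BConst) : Constr → Set where
  gnd-l : ∀ {s r t} → BConstInTerm c s → BConstInConstr c (gnd s r t)
  gnd-r : ∀ {s r t} → BConstInTerm c t → BConstInConstr c (gnd s r t)
  vt-t  : ∀ {x r t} → BConstInTerm c t → BConstInConstr c (vt x r t)

BConstOccurs : List Clause → BConst → Set
BConstOccurs N c = ∃[ D ] (D ∈ N × Any (BConstInConstr c) (Λ D))

FConstOccurs : List Clause → Set
FConstOccurs N = ∃[ D ] (D ∈ N × ∃[ a ] Any (FTermInAtom (fcon a)) (Atoms D))

NFConstr : Constr → Set
NFConstr (gnd _ _ _) = ⊤
NFConstr (vt x r t)  = (r ≡ le ⊎ r ≡ eq ⊎ r ≡ ge) × ∃[ c ] t ≡ con c
NFConstr (vv x r y)  = r ≡ le ⊎ r ≡ ge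

record NormalForm (N : List Clause) : Set where
  field
    nf-constr   : ∀ D → D ∈ N → All NFConstr (Λ D)
    nf-vars     : ∀ D → D ∈ N → ∀ x → Any (BVarIn x) (Λ D) → BVarInAtoms D x
    nf-noVarEq  : ∀ D → D ∈ N → ∀ a → a ∈ Γ D → ∀ u t →
                  a ≢ (fvar u ≈ₐ t) × a ≢ (t ≈ₐ fvar u)
    nf-disjoint : ∀ (i j : Fin (length N)) → i ≢ j →
                  (∀ x → BVarOf (lookup N i) x → ¬ BVarOf (lookup N j) x) ×
                  (∀ u → FVarOf (lookup N i) u → ¬ FVarOf (lookup N j) u)
    nf-fconst   : FConstOccurs N

EqIn LeIn : List Constr → ℕ → ℕ → Set
EqIn L u v = vv u eq v ∈ L ⊎ vv v eq u ∈ L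
LeIn L u v = vv u le v ∈ L ⊎ vv v ge u ∈ L

FEqIn : Clause → ℕ → ℕ → Set
FEqIn D a b = (fvar a ≈ₐ fvar b) ∈ Atoms D ⊎ (fvar b ≈ₐ fvar a) ∈ Atoms D

-- links between the argument u (at the smaller position) and v
Link : Clause → (s : Sort) → ArgOf s → ArgOf s → Set
Link D base u v = u ≡ v ⊎ EqIn (Λ D) u v ⊎ LeIn (Λ D) u v
Link D free u v = ∃[ a ] ∃[ b ] (u ≡ fvar a × v ≡ fvar b × (a ≡ b ⊎ FEqIn D a b))

Gen : List Clause → Pos → Pos → Set
Gen N q p = ∃[ D ] (D ∈ N × ∃[ s ] ∃[ u ] ∃[ v ]
              (OccAt D q s u × OccAt D p s v × Link D s u v))

data _⊑[_]_ : Pos → List Clause → Pos → Set where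
  ⊑-refl  : ∀ {N p} → p ⊑[ N ] p
  ⊑-gen   : ∀ {N p q} → Gen N q p → q ⊑[ N ] p
  ⊑-trans : ∀ {N p q r} → p ⊑[ N ] q → q ⊑[ N ] r → p ⊑[ N ] r

IPos : List Clause → Pos → BConst → Set
IPos N p d = ∃[ D ] (D ∈ N × ∃[ x ] (OccAt D p base x ×
               (vt x eq (con d) ∈ Λ D ⊎ vt x ge (con d) ∈ Λ D)))

I↓ : List Clause → Pos → BConst → Set
I↓ N p d = d ≡ c-∞ ⊎ ∃[ q ] (q ⊑[ N ] p × IPos N q d)

I↓var : List Clause → ℕ → BConst → Set
I↓var N x d = ∃[ D ] (D ∈ N × ∃[ p ] (OccAt D p base x × I↓ N p d))

PsiClause : BConst → Clause
PsiClause c = (gnd (con c-∞) ge (con c) ∷ []) ∥ [] ⇒ []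

InPsi : List Clause → Clause → Set
InPsi N D = ∃[ c ] (BConstOccurs N c × c ≢ c-∞ × D ≡ PsiClause c)

flipRel : Rel → Rel
flipRel lt = gt
flipRel le = ge
flipRel eq = eq
flipRel ne = ne
flipRel ge = le
flipRel gt = lt

substC : ℕ → BConst → Constr → Constr
substC x c (gnd s r t) = gnd s r t
substC x c (vt y r t) = if does (y ℕ.≟ x) then gnd (con c) r t else vt y r t
substC x c (vv y r z) with does (y ℕ.≟ x) | does (z ℕ.≟ x)
... | true  | true  = gnd (con c) r (con c)
... | true  | false = vt z (flipRel r) (con c)
... | false | true  = vt y r (con c)
... | false | false = vv y r z

inst : Clause → ℕ → BConst → Clause
inst (L ∥ G ⇒ D) x c = (map (substC x c) L ++ vt x eq (con c) ∷ []) ∥ G ⇒ D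

Nhat : List Clause → Clause → ℕ → Clause → Set
Nhat N C x D = (D ∈ N × D ≢ C)
             ⊎ (∃[ c ] (I↓var N x c × D ≡ inst C x c))
             ⊎ InPsi N D

Val : Set → Sort → Set
Val U base = ℤ
Val U free = U

record Interp : Set₁ where
  field
    U   : Set
    u₀  : U                 -- free sort nonempty
    skv : ℕ → ℤ
    c∞v : ℤ
    fc  : ℕ → U
    pr  : (P : PSym) → All (Val U) (sorts P) → Set

module _ (I : Interp) where
  open Interp I

  evalC : BConst → ℤ
  evalC (num z) = z
  evalC (sk n)  = skv n
  evalC c-∞     = c∞v

  evalT : GTerm → ℤ
  evalT (con c) = evalC c
  evalT (s ⊕ t) = evalT s ℤ.+ evalT t
  evalT (s ⊖ t) = evalT s ℤ.- evalT t

  ⟦_⟧R : Rel → ℤ → ℤ → Set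
  ⟦ lt ⟧R a b = a ℤ.< b
  ⟦ le ⟧R a b = a ℤ.≤ b
  ⟦ eq ⟧R a b = a ≡ b
  ⟦ ne ⟧R a b = a ≢ b
  ⟦ ge ⟧R a b = a ℤ.≥ b
  ⟦ gt ⟧R a b = a ℤ.> b

  CSat : (ℕ → ℤ) → Constr → Set
  CSat β (gnd s r t) = ⟦ r ⟧R (evalT s) (evalT t)
  CSat β (vt x r t)  = ⟦ r ⟧R (β x) (evalT t)
  CSat β (vv x r y)  = ⟦ r ⟧R (β x) (β y)

  evalF : (ℕ → U) → FTerm → U
  evalF γ (fvar u) = γ u
  evalF γ (fcon a) = fc a

  evalArg : (ℕ → ℤ) → (ℕ → U) → ∀ {s} → ArgOf s → Val U s
  evalArg β γ {base} x = β x
  evalArg β γ {free} t = evalF γ t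

  ASat : (ℕ → ℤ) → (ℕ → U) → Atom → Set
  ASat β γ (s ≈ₐ t)     = evalF γ s ≡ evalF γ t
  ASat β γ (app P args) = pr P (All.map (evalArg β γ) args)

  Models : Clause → Set
  Models D = ∀ (β : ℕ → ℤ) (γ : ℕ → U) →
             All (CSat β) (Λ D) → All (ASat β γ) (Γ D) → Any (ASat β γ) (Δ D)

Satisfiable : (Clause → Set) → Set₁
Satisfiable S = ∃[ I ] (∀ D → S D → Models I D)

-- N̂ₓ is satisfiable when N is: instances of C are consequences of C, and if
-- c-∞ does not occur in N it can be reinterpreted below every constant of N,
-- which makes Ψ true.
--
-- Conversely let I ⊨ N̂ₓ, and let S be a finite set of argument positions that
-- contains a position of x, lies in ↓_N(x), and is closed backwards under the
-- links that generate ⊑_N.  The thresholds are the lower bounds d (from x = d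
-- or x ≥ d) attached to positions in S; all of them lie in 𝓘_{↓_N(x)}.  Let J
-- be I with each predicate reading its base arguments projected: at positions
-- in S a value is rounded down to the largest threshold below it (c-∞ if there
-- is none), elsewhere it is raised to at least c-∞.  Both projections are
-- monotone and preserve x ≤ c, as c-∞ < c by Ψ; rounding down preserves x ≥ d
-- and x = d because every such d at a position in S is a threshold, and raising
-- preserves them trivially.  Closedness of S makes all positions of a variable
-- agree and respects x ≤ y.  Hence J ⊨ D follows from I ⊨ D for D ≠ C, and
-- J ⊨ C from I ⊨ C{x/d} for the threshold d below the value of x.
module Submission where

open import Defs
open import Data.Bool as Bool using (Bool; true; false)
open import Data.Bool.Properties using (T-≡)
import Data.Fin as Fin
open import Data.Integer as ℤ using (ℤ; _⊔_)
import Data.Integer.Properties as ℤ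
open import Data.List using (List; []; _∷_; _++_; map; filter; concatMap; cartesianProduct; length; lookup)
open import Data.List.Extrema ℤ.≤-totalOrder
  using (argmax; argmax-sel; f[⊥]≤f[argmax]; f[xs]≤f[argmax]; f[argmax]≤v⁺; min; min≤xs)
open import Data.List.Membership.Propositional using (_∈_; _∉_; find; lose)
open import Data.List.Membership.Propositional.Properties
import Data.List.Properties as List
open import Data.List.Relation.Binary.Subset.Propositional using (_⊆_)
open import Data.List.Relation.Unary.All as All using (All; []; _∷_)
open import Data.List.Relation.Unary.All.Properties using (all-filter; ++⁺; ++⁻; map⁺; map⁻; map-cong)
open import Data.List.Relation.Unary.Any as Any using (Any; here; there)
open import Data.List.Relation.Unary.Any.Properties using (¬Any[]; lookup-index)
open import Data.Nat as ℕ using (ℕ; suc)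
open import Data.Nat.Induction using (<-wellFounded)
open import Data.Nat.Properties using (≡ᵇ⇒≡)
import Data.Product as Product
open Product using (∃-syntax; _×_; _,_; proj₁; proj₂)
open import Data.Product.Properties using (≡-dec)
import Data.Sum as Sum
open Sum using (_⊎_; inj₁; inj₂)
open import Function using (_∘_; _∘′_; id)
open import Function.Bundles using (_⇔_; mk⇔; Equivalence)
import Function.Properties.Equivalence as ⇔
open import Induction.WellFounded using (Acc; acc)
open import Relation.Binary.Definitions using (DecidableEquality)
open import Relation.Binary.PropositionalEquality using (_≡_; _≢_; refl; sym; trans; cong; cong₂; subst)
open import Relation.Nullary using (Dec; yes; no; does; ¬_; ¬?; _×-dec_; _⊎-dec_; contradiction)
import Relation.Nullary.Decidable as Dec

open Equivalence using (to; from)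

does-mono : ∀ {P Q : Set} (P? : Dec P) (Q? : Dec Q) → (P → Q) → does P? Bool.≤ does Q?
does-mono (yes _) (yes _) _ = Bool.b≤b
does-mono (no _) (yes _) _ = Bool.f≤t
does-mono (no _) (no _) _ = Bool.b≤b
does-mono (yes p) (no ¬q) P→Q = contradiction (P→Q p) ¬q

≡ᵇ-true⇒≡ : ∀ m n → (m ℕ.≡ᵇ n) ≡ true → m ≡ n
≡ᵇ-true⇒≡ m n p = ≡ᵇ⇒≡ m n (T-≡ .from p)

∈-concatMap⇔ : ∀ {A B : Set} (f : A → List B) {xs y} →
               y ∈ concatMap f xs ⇔ (∃[ x ] (x ∈ xs × y ∈ f x))
∈-concatMap⇔ f {xs} =
  mk⇔ (find ∘ ∈-concatMap⁻ f {xs = xs}) (λ (_ , x∈ , y∈) → ∈-concatMap⁺ f (lose x∈ y∈))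

module _ {A B K L : Set} {R : K → L → Set} (R? : ∀ k l → Dec (R k l)) where

  private
    outer : (A × K) × (B × L) → A × B
    outer ((a , _) , (b , _)) = a , b

    Related : (A × K) × (B × L) → Set
    Related ((_ , k) , (_ , l)) = R k l

    related? : ∀ o → Dec (Related o)
    related? ((_ , k) , (_ , l)) = R? k l

  joinBy : List (A × K) → List (B × L) → List (A × B)
  joinBy xs ys = map outer (filter related? (cartesianProduct xs ys))

  ∈-joinBy : ∀ xs ys {a b} →
             (a , b) ∈ joinBy xs ys ⇔ (∃[ k ] ∃[ l ] ((a , k) ∈ xs × (b , l) ∈ ys × R k l))
  ∈-joinBy xs ys = mk⇔ sound complete
    where
      sound : ∀ {a b} → (a , b) ∈ joinBy xs ys → ∃[ k ] ∃[ l ] ((a , k) ∈ xs × (b , l) ∈ ys × R k l)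
      sound m with ((_ , k) , (_ , l)) , m′ , refl , r ← ∈-map∘filter⁻ outer related? m
        with a∈ , b∈ ← ∈-cartesianProduct⁻ xs ys m′ = k , l , a∈ , b∈ , r

      complete : ∀ {a b} → ∃[ k ] ∃[ l ] ((a , k) ∈ xs × (b , l) ∈ ys × R k l) → (a , b) ∈ joinBy xs ys
      complete (k , l , a∈ , b∈ , r) =
        ∈-map∘filter⁺ outer related? (_ , ∈-cartesianProduct⁺ a∈ b∈ , refl , r)

module BackwardClosure {A : Set} (_≟_ : DecidableEquality A) (E : List (A × A)) where

  open import Data.List.Membership.DecPropositional _≟_ using (_∈?_)

  Closed : List A → Set
  Closed S = ∀ {q p} → (q , p) ∈ E → p ∈ S → q ∈ S

  module _ (R : A → Set) (R-back : ∀ {q p} → (q , p) ∈ E → R p → R q) where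

    private
      -- Invariant: the source of every edge is in S or pending.  Each step moves
      -- one pending vertex into S and out of pending, the termination measure.
      grow : (S pending : List A) → Acc ℕ._<_ (length pending) →
             (∀ {q p} → (q , p) ∈ E → q ∉ S → q ∈ pending) → All R S →
             ∃[ S′ ] (S ⊆ S′ × All R S′ × Closed S′)
      grow S pending (acc rec) covers RS
        with Any.any? (λ e → (proj₂ e ∈? S) ×-dec ¬? (proj₁ e ∈? S)) E
      ... | no none = S , id , RS , closed
        where
          closed : Closed S
          closed {q} e p∈S = Dec.decidable-stable (q ∈? S) (λ q∉S → none (lose e (p∈S , q∉S)))
      ... | yes some with (q , p) , e , p∈S , q∉S ← find some =
        let S′ , S⊆S′ , RS′ , closed =
              grow (q ∷ S) pending′ (rec shrinks) covers′ (R-back e (All.lookup RS p∈S) ∷ RS)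
        in S′ , S⊆S′ ∘ there , RS′ , closed
        where
          pending′ : List A
          pending′ = filter (λ a → ¬? (a ≟ q)) pending

          shrinks : length pending′ ℕ.< length pending
          shrinks = List.filter-notAll _ pending (Any.map (λ q≡a a≢q → a≢q (sym q≡a)) (covers e q∉S))

          covers′ : ∀ {q′ p′} → (q′ , p′) ∈ E → q′ ∉ q ∷ S → q′ ∈ pending′
          covers′ e′ q′∉ = ∈-filter⁺ _ (covers e′ (q′∉ ∘ there)) (q′∉ ∘ here)

    closure : ∀ {s} → R s → ∃[ S ] (s ∈ S × All R S × Closed S)
    closure {s} Rs
      with S , s∷[]⊆S , RS , closed ←
             grow (s ∷ []) (map proj₁ E) (<-wellFounded _) (λ e _ → ∈-map⁺ proj₁ e) (Rs ∷ [])
      = S , s∷[]⊆S (here refl) , RS , closed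

module RoundDown {A : Set} (val : A → ℤ) (⊥ : A) (thresholds : List A) where

  _≤?ᵥ_ : ∀ c v → Dec (val c ℤ.≤ v)
  c ≤?ᵥ v = val c ℤ.≤? v

  candidates : ℤ → List A
  candidates v = filter (_≤?ᵥ v) thresholds

  roundDown : ℤ → A
  roundDown v = argmax val ⊥ (candidates v)

  roundDown-sel : ∀ v → roundDown v ≡ ⊥ ⊎ (roundDown v ∈ thresholds × val (roundDown v) ℤ.≤ v)
  roundDown-sel v = Sum.map₂ (∈-filter⁻ (_≤?ᵥ v)) (argmax-sel val ⊥ (candidates v))

  project : Bool → ℤ → ℤ
  project true v = val (roundDown v)
  project false v = val ⊥ ⊔ v

  ⊥≤project : ∀ b v → val ⊥ ℤ.≤ project b v
  ⊥≤project true v = f[⊥]≤f[argmax] {f = val} ⊥ (candidates v)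
  ⊥≤project false v = ℤ.i≤i⊔j (val ⊥) v

  project≤⊥⊔ : ∀ b v → project b v ℤ.≤ val ⊥ ⊔ v
  project≤⊥⊔ true v =
    f[argmax]≤v⁺ {f = val} (ℤ.i≤i⊔j (val ⊥) v)
                 (All.map (ℤ.i≤j⇒i≤k⊔j (val ⊥)) (all-filter (_≤?ᵥ v) thresholds))
  project≤⊥⊔ false v = ℤ.≤-refl

  project≤ : ∀ b {v d} → v ℤ.≤ d → val ⊥ ℤ.≤ d → project b v ℤ.≤ d
  project≤ b v≤d ⊥≤d = ℤ.≤-trans (project≤⊥⊔ b _) (ℤ.⊔-lub ⊥≤d v≤d)

  threshold≤project : ∀ {P : Set} (P? : Dec P) {v c} →
                      (P → c ∈ thresholds) → val c ℤ.≤ v → val c ℤ.≤ project (does P?) v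
  threshold≤project (yes p) {v} c∈ c≤v =
    All.lookup (f[xs]≤f[argmax] {f = val} ⊥ (candidates v)) (∈-filter⁺ (_≤?ᵥ v) (c∈ p) c≤v)
  threshold≤project (no _) _ c≤v = ℤ.i≤j⇒i≤k⊔j (val ⊥) c≤v

  project-mono : ∀ {b₁ b₂ v w} → b₂ Bool.≤ b₁ → v ℤ.≤ w → project b₁ v ℤ.≤ project b₂ w
  project-mono {true} {v = v} {w} Bool.b≤b v≤w with roundDown-sel v
  ... | inj₁ ⊥≡ rewrite ⊥≡ = ⊥≤project true w
  ... | inj₂ (c∈ , c≤v) = threshold≤project (yes c∈) id (ℤ.≤-trans c≤v v≤w)
  project-mono {false} Bool.b≤b v≤w = ℤ.⊔-monoʳ-≤ (val ⊥) v≤w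
  project-mono Bool.f≤t v≤w = ℤ.≤-trans (project≤⊥⊔ true _) (ℤ.⊔-monoʳ-≤ (val ⊥) v≤w)

sort≟ : DecidableEquality Sort
sort≟ base base = yes refl
sort≟ base free = no λ ()
sort≟ free base = no λ ()
sort≟ free free = yes refl

psym≟ : DecidableEquality PSym
psym≟ (psym n ss) (psym m ts) =
  Dec.map′ (λ { (refl , refl) → refl }) (λ { refl → refl , refl }) ((n ℕ.≟ m) ×-dec List.≡-dec sort≟ ss ts)

pos≟ : DecidableEquality Pos
pos≟ = ≡-dec psym≟ ℕ._≟_

baseArgs : ∀ {ss} → All ArgOf ss → List (ℕ × ℕ)
baseArgs [] = []
baseArgs {base ∷ _} (y ∷ as) = (0 , y) ∷ map (Product.map₁ suc) (baseArgs as)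
baseArgs {free ∷ _} (_ ∷ as) = map (Product.map₁ suc) (baseArgs as)

∈-baseArgs : ∀ {ss} {as : All ArgOf ss} {i y} → (i , y) ∈ baseArgs as ⇔ ArgAt as i base y
∈-baseArgs = mk⇔ (sound _) complete
  where
    sound : ∀ {ss} (as : All ArgOf ss) {i y} → (i , y) ∈ baseArgs as → ArgAt as i base y
    sound {base ∷ _} (y ∷ as) (here refl) = here
    sound {base ∷ _} (y ∷ as) (there m) with _ , m′ , refl ← ∈-map⁻ (Product.map₁ suc) m = there (sound as m′)
    sound {free ∷ _} (_ ∷ as) m with _ , m′ , refl ← ∈-map⁻ (Product.map₁ suc) m = there (sound as m′)

    complete : ∀ {ss} {as : All ArgOf ss} {i y} → ArgAt as i base y → (i , y) ∈ baseArgs as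
    complete {base ∷ _} here = here refl
    complete {base ∷ _} (there at) = there (∈-map⁺ (Product.map₁ suc) (complete at))
    complete {free ∷ _} (there at) = ∈-map⁺ (Product.map₁ suc) (complete at)

atomOccs : Atom → List (Pos × ℕ)
atomOccs (_ ≈ₐ _) = []
atomOccs (app P args) = map (Product.map₁ (P ,_)) (baseArgs args)

occs : Clause → List (Pos × ℕ)
occs D = concatMap atomOccs (Atoms D)

∈-occs : ∀ D {p y} → (p , y) ∈ occs D ⇔ OccAt D p base y
∈-occs D = mk⇔ sound complete
  where
    sound : ∀ {p y} → (p , y) ∈ occs D → OccAt D p base y
    sound m with ∈-concatMap⇔ atomOccs {Atoms D} .to m
    ... | app P args , a∈ , m′ with _ , m″ , refl ← ∈-map⁻ (Product.map₁ (P ,_)) m′ =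
      args , a∈ , ∈-baseArgs .to m″

    complete : ∀ {p y} → OccAt D p base y → (p , y) ∈ occs D
    complete {P , _} (args , a∈ , at) =
      ∈-concatMap⇔ atomOccs .from (app P args , a∈ , ∈-map⁺ (Product.map₁ (P ,_)) (∈-baseArgs .from at))

leOf : Constr → List (ℕ × ℕ)
leOf (vv y le z) = (y , z) ∷ []
leOf (vv y ge z) = (z , y) ∷ []
leOf _ = []

lePairs : List Constr → List (ℕ × ℕ)
lePairs = concatMap leOf

∈-lePairs : ∀ {L y z} → (y , z) ∈ lePairs L ⇔ LeIn L y z
∈-lePairs {L} = mk⇔ sound complete
  where
    sound : ∀ {y z} → (y , z) ∈ lePairs L → LeIn L y z
    sound m with ∈-concatMap⇔ leOf {L} .to m
    ... | vv _ le _ , k∈ , here refl = inj₁ k∈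
    ... | vv _ ge _ , k∈ , here refl = inj₂ k∈

    complete : ∀ {y z} → LeIn L y z → (y , z) ∈ lePairs L
    complete (inj₁ k∈) = ∈-concatMap⇔ leOf .from (_ , k∈ , here refl)
    complete (inj₂ k∈) = ∈-concatMap⇔ leOf .from (_ , k∈ , here refl)

LowerBoundIn : List Constr → ℕ → BConst → Set
LowerBoundIn L y c = vt y eq (con c) ∈ L ⊎ vt y ge (con c) ∈ L

lowerBoundOf : Constr → List (BConst × ℕ)
lowerBoundOf (vt y eq (con c)) = (c , y) ∷ []
lowerBoundOf (vt y ge (con c)) = (c , y) ∷ []
lowerBoundOf _ = []

lowerBounds : List Constr → List (BConst × ℕ)
lowerBounds = concatMap lowerBoundOf

∈-lowerBounds : ∀ {L y c} → (c , y) ∈ lowerBounds L ⇔ LowerBoundIn L y c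
∈-lowerBounds {L} = mk⇔ sound complete
  where
    sound : ∀ {y c} → (c , y) ∈ lowerBounds L → LowerBoundIn L y c
    sound m with ∈-concatMap⇔ lowerBoundOf {L} .to m
    ... | vt _ eq (con _) , k∈ , here refl = inj₁ k∈
    ... | vt _ ge (con _) , k∈ , here refl = inj₂ k∈

    complete : ∀ {y c} → LowerBoundIn L y c → (c , y) ∈ lowerBounds L
    complete (inj₁ k∈) = ∈-concatMap⇔ lowerBoundOf .from (_ , k∈ , here refl)
    complete (inj₂ k∈) = ∈-concatMap⇔ lowerBoundOf .from (_ , k∈ , here refl)

-- the base-sort Link without its EqIn case: normal-form clauses have no x = y constraints
Linked : Clause → ℕ → ℕ → Set
Linked D y z = y ≡ z ⊎ LeIn (Λ D) y z

linked? : ∀ D y z → Dec (Linked D y z)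
linked? D y z = (y ℕ.≟ z) ⊎-dec Dec.map ∈-lePairs (Any.any? (≡-dec ℕ._≟_ ℕ._≟_ (y , z)) (lePairs (Λ D)))

LinkedAt : List Clause → Pos → Pos → Set
LinkedAt N q p = ∃[ D ] (D ∈ N × ∃[ y ] ∃[ z ] (OccAt D q base y × OccAt D p base z × Linked D y z))

LinkedAt⇒Gen : ∀ {N q p} → LinkedAt N q p → Gen N q p
LinkedAt⇒Gen (D , D∈ , y , z , occ-q , occ-p , link) = D , D∈ , base , y , z , occ-q , occ-p , Sum.map₂ inj₂ link

edgesOf : Clause → List (Pos × Pos)
edgesOf D = joinBy (linked? D) (occs D) (occs D)

edges : List Clause → List (Pos × Pos)
edges = concatMap edgesOf

∈-edges : ∀ {N q p} → (q , p) ∈ edges N ⇔ LinkedAt N q p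
∈-edges = mk⇔ sound complete
  where
    sound : ∀ {N q p} → (q , p) ∈ edges N → LinkedAt N q p
    sound m with D , D∈ , m′ ← ∈-concatMap⇔ edgesOf .to m
      with y , z , q∈ , p∈ , link ← ∈-joinBy (linked? D) (occs D) (occs D) .to m′ =
      D , D∈ , y , z , ∈-occs D .to q∈ , ∈-occs D .to p∈ , link

    complete : ∀ {N q p} → LinkedAt N q p → (q , p) ∈ edges N
    complete (D , D∈ , y , z , occ-q , occ-p , link) = ∈-concatMap⇔ edgesOf .from (D , D∈ ,
      ∈-joinBy (linked? D) (occs D) (occs D) .from (y , z , ∈-occs D .from occ-q , ∈-occs D .from occ-p , link))

boundsOf : Clause → List (Pos × BConst)
boundsOf D = joinBy ℕ._≟_ (occs D) (lowerBounds (Λ D))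

bounds : List Clause → List (Pos × BConst)
bounds = concatMap boundsOf

∈-bounds : ∀ {N p c} → (p , c) ∈ bounds N ⇔ IPos N p c
∈-bounds = mk⇔ sound complete
  where
    sound : ∀ {N p c} → (p , c) ∈ bounds N → IPos N p c
    sound m with D , D∈ , m′ ← ∈-concatMap⇔ boundsOf .to m
      with y , _ , p∈ , c∈ , refl ← ∈-joinBy ℕ._≟_ (occs D) (lowerBounds (Λ D)) .to m′ =
      D , D∈ , y , ∈-occs D .to p∈ , ∈-lowerBounds .to c∈

    complete : ∀ {N p c} → IPos N p c → (p , c) ∈ bounds N
    complete (D , D∈ , y , occ , lb) = ∈-concatMap⇔ boundsOf .from (D , D∈ ,
      ∈-joinBy ℕ._≟_ (occs D) (lowerBounds (Λ D)) .from (y , y , ∈-occs D .from occ , ∈-lowerBounds .from lb , refl))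

constantsT : GTerm → List BConst
constantsT (con c) = c ∷ []
constantsT (s ⊕ t) = constantsT s ++ constantsT t
constantsT (s ⊖ t) = constantsT s ++ constantsT t

∈-constantsT : ∀ t {c} → c ∈ constantsT t ⇔ BConstInTerm c t
∈-constantsT (con _) = mk⇔ (λ { (here refl) → here }) (λ { here → here refl })
∈-constantsT (s ⊕ t) =
  mk⇔ (Sum.[ ⊕ˡ ∘ ∈-constantsT s .to , ⊕ʳ ∘ ∈-constantsT t .to ] ∘ ∈-++⁻ (constantsT s))
      λ { (⊕ˡ h) → ∈-++⁺ˡ (∈-constantsT s .from h)
        ; (⊕ʳ h) → ∈-++⁺ʳ (constantsT s) (∈-constantsT t .from h) }
∈-constantsT (s ⊖ t) =
  mk⇔ (Sum.[ ⊖ˡ ∘ ∈-constantsT s .to , ⊖ʳ ∘ ∈-constantsT t .to ] ∘ ∈-++⁻ (constantsT s))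
      λ { (⊖ˡ h) → ∈-++⁺ˡ (∈-constantsT s .from h)
        ; (⊖ʳ h) → ∈-++⁺ʳ (constantsT s) (∈-constantsT t .from h) }

constantsC : Constr → List BConst
constantsC (gnd s _ t) = constantsT s ++ constantsT t
constantsC (vt _ _ t) = constantsT t
constantsC (vv _ _ _) = []

∈-constantsC : ∀ k {c} → c ∈ constantsC k ⇔ BConstInConstr c k
∈-constantsC (gnd s _ t) =
  mk⇔ (Sum.[ gnd-l ∘ ∈-constantsT s .to , gnd-r ∘ ∈-constantsT t .to ] ∘ ∈-++⁻ (constantsT s))
      λ { (gnd-l h) → ∈-++⁺ˡ (∈-constantsT s .from h)
        ; (gnd-r h) → ∈-++⁺ʳ (constantsT s) (∈-constantsT t .from h) }
∈-constantsC (vt _ _ t) = mk⇔ (vt-t ∘ ∈-constantsT t .to) λ { (vt-t h) → ∈-constantsT t .from h }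
∈-constantsC (vv _ _ _) = mk⇔ (λ ()) (λ ())

constantsOf : Clause → List BConst
constantsOf D = concatMap constantsC (Λ D)

constants : List Clause → List BConst
constants = concatMap constantsOf

∈-constants : ∀ N {c} → c ∈ constants N ⇔ BConstOccurs N c
∈-constants N {c} = mk⇔ sound complete
  where
    sound : c ∈ constants N → BConstOccurs N c
    sound m with D , D∈ , m′ ← ∈-concatMap⇔ constantsOf .to m
      with k , k∈ , m″ ← ∈-concatMap⇔ constantsC .to m′ = D , D∈ , lose k∈ (∈-constantsC k .to m″)

    complete : BConstOccurs N c → c ∈ constants N
    complete (D , D∈ , occ) with k , k∈ , h ← find occ =
      ∈-concatMap⇔ constantsOf .from (D , D∈ , ∈-concatMap⇔ constantsC .from (k , k∈ , ∈-constantsC k .from h))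

c-∞≟ : ∀ c → Dec (c-∞ ≡ c)
c-∞≟ (num _) = no λ ()
c-∞≟ (sk _) = no λ ()
c-∞≟ c-∞ = yes refl

c-∞-occurs? : ∀ N → Dec (BConstOccurs N c-∞)
c-∞-occurs? N = Dec.map (∈-constants N) (Any.any? c-∞≟ (constants N))

≡⊎≢-clause : ∀ {N C D x} → NormalForm N → C ∈ N → BVarOf C x → D ∈ N → D ≡ C ⊎ D ≢ C
≡⊎≢-clause {N} {C} {x = x} nf C∈ x∈C D∈ with Any.index D∈ Fin.≟ Any.index C∈
... | yes same = inj₁ (trans (lookup-index D∈) (trans (cong (lookup N) same) (sym (lookup-index C∈))))
... | no differ = inj₂ λ { refl → proj₁ (NormalForm.nf-disjoint nf _ _ differ) x (at D∈) (at C∈) }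
  where
    at : (C∈′ : C ∈ N) → BVarOf (lookup N (Any.index C∈′)) x
    at C∈′ = subst (λ E → BVarOf E x) (lookup-index C∈′) x∈C

module _ {I J : Interp} where

  ⟦⟧R-transport : ∀ r {a b} → ⟦_⟧R I r a b → ⟦_⟧R J r a b
  ⟦⟧R-transport lt = id
  ⟦⟧R-transport le = id
  ⟦⟧R-transport eq = id
  ⟦⟧R-transport ne = id
  ⟦⟧R-transport ge = id
  ⟦⟧R-transport gt = id

  evalT-cong : ∀ t → (∀ c → BConstInTerm c t → evalC I c ≡ evalC J c) → evalT I t ≡ evalT J t
  evalT-cong (con c) agree = agree c here
  evalT-cong (s ⊕ t) agree =
    cong₂ ℤ._+_ (evalT-cong s (λ c → agree c ∘ ⊕ˡ)) (evalT-cong t (λ c → agree c ∘ ⊕ʳ))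
  evalT-cong (s ⊖ t) agree =
    cong₂ ℤ._-_ (evalT-cong s (λ c → agree c ∘ ⊖ˡ)) (evalT-cong t (λ c → agree c ∘ ⊖ʳ))

  CSat-cong : ∀ β k → (∀ c → BConstInConstr c k → evalC I c ≡ evalC J c) → CSat I β k → CSat J β k
  CSat-cong β (gnd s r t) agree
    rewrite evalT-cong s (λ c → agree c ∘ gnd-l) | evalT-cong t (λ c → agree c ∘ gnd-r) = ⟦⟧R-transport r
  CSat-cong β (vt y r t) agree rewrite evalT-cong t (λ c → agree c ∘ vt-t) = ⟦⟧R-transport r
  CSat-cong β (vv y r z) agree = ⟦⟧R-transport r

module _ (I : Interp) where

  flipRel-⇔ : ∀ r {a b} → ⟦_⟧R I (flipRel r) b a ⇔ ⟦_⟧R I r a b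
  flipRel-⇔ lt = ⇔.refl
  flipRel-⇔ le = ⇔.refl
  flipRel-⇔ eq = mk⇔ sym sym
  flipRel-⇔ ne = mk⇔ (_∘′ sym) (_∘′ sym)
  flipRel-⇔ ge = ⇔.refl
  flipRel-⇔ gt = ⇔.refl

  -- substC tests variables with does (y ≟ x), which computes to y ≡ᵇ x.
  CSat-substC : ∀ β {x c} → β x ≡ evalC I c → ∀ k → CSat I β (substC x c k) ⇔ CSat I β k
  CSat-substC β βx≡c (gnd s r t) = ⇔.refl
  CSat-substC β {x} βx≡c (vt y r t) with y ℕ.≡ᵇ x in y≟x
  ... | true with refl ← ≡ᵇ-true⇒≡ y x y≟x rewrite βx≡c = ⇔.refl
  ... | false = ⇔.refl
  CSat-substC β {x} βx≡c (vv y r z) with y ℕ.≡ᵇ x in y≟x | z ℕ.≡ᵇ x in z≟x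
  ... | true  | true  with refl ← ≡ᵇ-true⇒≡ y x y≟x | refl ← ≡ᵇ-true⇒≡ z x z≟x rewrite βx≡c = ⇔.refl
  ... | true  | false with refl ← ≡ᵇ-true⇒≡ y x y≟x rewrite βx≡c = flipRel-⇔ r
  ... | false | true  with refl ← ≡ᵇ-true⇒≡ z x z≟x rewrite βx≡c = ⇔.refl
  ... | false | false = ⇔.refl

  CSat-inst : ∀ β D {x c} → All (CSat I β) (Λ (inst D x c)) ⇔ (β x ≡ evalC I c × All (CSat I β) (Λ D))
  CSat-inst β D {x} {c} = mk⇔ split join
    where
      split : All (CSat I β) (Λ (inst D x c)) → β x ≡ evalC I c × All (CSat I β) (Λ D)
      split h with h-subst , βx≡c ∷ [] ← ++⁻ (map (substC x c) (Λ D)) h =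
        βx≡c , All.map (λ {k} → CSat-substC β βx≡c k .to) (map⁻ h-subst)

      join : β x ≡ evalC I c × All (CSat I β) (Λ D) → All (CSat I β) (Λ (inst D x c))
      join (βx≡c , h) = ++⁺ (map⁺ (All.map (λ {k} → CSat-substC β βx≡c k .from) h)) (βx≡c ∷ [])

  Models-inst : ∀ D {x c} → Models I D → Models I (inst D x c)
  Models-inst D I⊨D β γ Λ⊨ = I⊨D β γ (proj₂ (CSat-inst β D .to Λ⊨))

  Models-PsiClause : ∀ {c} → Models I (PsiClause c) ⇔ Interp.c∞v I ℤ.< evalC I c
  Models-PsiClause = mk⇔
    (λ I⊨ψ → ℤ.≰⇒> λ c≤c∞ → ¬Any[] (I⊨ψ (λ _ → ℤ.0ℤ) (λ _ → Interp.u₀ I) (c≤c∞ ∷ []) []))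
    (λ c∞<c β γ → λ { (c≤c∞ ∷ []) [] → contradiction c≤c∞ (ℤ.<⇒≱ c∞<c) })

Ψ-Holds : List Clause → Interp → Set
Ψ-Holds N I = ∀ c → BConstOccurs N c → c ≢ c-∞ → Interp.c∞v I ℤ.< evalC I c

-- From N to N̂ₓ

_[c∞≔_] : Interp → ℤ → Interp
I [c∞≔ v ] = record I { c∞v = v }

module _ (I : Interp) (v : ℤ) where

  evalC-[c∞≔] : ∀ c → c ≢ c-∞ → evalC (I [c∞≔ v ]) c ≡ evalC I c
  evalC-[c∞≔] (num _) _ = refl
  evalC-[c∞≔] (sk _) _ = refl
  evalC-[c∞≔] c-∞ c≢c∞ = contradiction refl c≢c∞

  ASat-[c∞≔] : ∀ β γ a → ASat (I [c∞≔ v ]) β γ a ≡ ASat I β γ a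
  ASat-[c∞≔] β γ (s ≈ₐ t) = cong₂ _≡_ (evalF-[c∞≔] s) (evalF-[c∞≔] t)
    where
      evalF-[c∞≔] : ∀ t → evalF (I [c∞≔ v ]) γ t ≡ evalF I γ t
      evalF-[c∞≔] (fvar _) = refl
      evalF-[c∞≔] (fcon _) = refl
  ASat-[c∞≔] β γ (app P args) = cong (Interp.pr I P) (map-cong args evalArg-[c∞≔])
    where
      evalArg-[c∞≔] : ∀ {s} (a : ArgOf s) → evalArg (I [c∞≔ v ]) β γ a ≡ evalArg I β γ a
      evalArg-[c∞≔] {base} _ = refl
      evalArg-[c∞≔] {free} (fvar _) = refl
      evalArg-[c∞≔] {free} (fcon _) = refl

  Models-[c∞≔] : ∀ D → ¬ Any (BConstInConstr c-∞) (Λ D) → Models I D → Models (I [c∞≔ v ]) D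
  Models-[c∞≔] D c∞∉D I⊨D β γ Λ⊨ Γ⊨ =
    Any.map (λ {a} → subst id (sym (ASat-[c∞≔] β γ a)))
      (I⊨D β γ (All.tabulate (λ {k} k∈ → CSat-cong β k (agree k∈) (All.lookup Λ⊨ k∈)))
               (All.map (λ {a} → subst id (ASat-[c∞≔] β γ a)) Γ⊨))
    where
      agree : ∀ {k} → k ∈ Λ D → ∀ c → BConstInConstr c k → evalC (I [c∞≔ v ]) c ≡ evalC I c
      agree k∈ c c∈k = evalC-[c∞≔] c λ { refl → c∞∉D (lose k∈ c∈k) }

∪Ψ-satisfiable : ∀ N → (BConstOccurs N c-∞ → ∀ D → InPsi N D → D ∈ N) →
                 Satisfiable (_∈ N) → ∃[ I ] ((∀ D → D ∈ N → Models I D) × Ψ-Holds N I)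
∪Ψ-satisfiable N Ψ⊆N (I , I⊨N) with c-∞-occurs? N
... | yes c∞∈N =
  I , I⊨N , λ c occ c≢c∞ → Models-PsiClause I .to (I⊨N _ (Ψ⊆N c∞∈N _ (c , occ , c≢c∞ , refl)))
... | no c∞∉N =
  I [c∞≔ v ] , (λ D D∈ → Models-[c∞≔] I v D (c∞∉N ∘ (D ,_) ∘ (D∈ ,_)) (I⊨N D D∈)) , below
  where
    v : ℤ
    v = ℤ.pred (min ℤ.0ℤ (map (evalC I) (constants N)))

    below : Ψ-Holds N (I [c∞≔ v ])
    below c occ c≢c∞ rewrite evalC-[c∞≔] I v c c≢c∞ =
      ℤ.<-≤-trans (ℤ.i≤pred[j]⇒i<j ℤ.≤-refl)
                  (All.lookup (min≤xs ℤ.0ℤ _) (∈-map⁺ (evalC I) (∈-constants N .from occ)))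

Nhat-models : ∀ {N C x I} → C ∈ N → (∀ D → D ∈ N → Models I D) → Ψ-Holds N I →
              ∀ D → Nhat N C x D → Models I D
Nhat-models C∈ I⊨N I⊨Ψ D (inj₁ (D∈ , _)) = I⊨N D D∈
Nhat-models {C = C} {I = I} C∈ I⊨N I⊨Ψ _ (inj₂ (inj₁ (_ , _ , refl))) = Models-inst I C (I⊨N C C∈)
Nhat-models {I = I} C∈ I⊨N I⊨Ψ _ (inj₂ (inj₂ (c , occ , c≢c∞ , refl))) =
  Models-PsiClause I .from (I⊨Ψ c occ c≢c∞)

-- From N̂ₓ to N

module Projection (N : List Clause) (nf : NormalForm N) {C : Clause} (C∈N : C ∈ N) {x : ℕ} {px : Pos}
                  (occ-x : OccAt C px base x) (I : Interp) (I⊨ : ∀ D → Nhat N C x D → Models I D) where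

  open Interp I
  open NormalForm nf
  open import Data.List.Membership.DecPropositional pos≟ using (_∈?_)
  open BackwardClosure pos≟ (edges N) using (Closed; closure)

  -- opaque: unfolding the closure computation makes type checking blow up
  opaque
    down-closure : ∃[ S ] (px ∈ S × All (_⊑[ N ] px) S × Closed S)
    down-closure = closure (_⊑[ N ] px) (λ e → ⊑-trans (⊑-gen (LinkedAt⇒Gen (∈-edges .to e)))) ⊑-refl

  S : List Pos
  S = proj₁ down-closure

  px∈S : px ∈ S
  px∈S = proj₁ (proj₂ down-closure)

  S⊑px : All (_⊑[ N ] px) S
  S⊑px = proj₁ (proj₂ (proj₂ down-closure))

  S-closed : Closed S
  S-closed = proj₂ (proj₂ (proj₂ down-closure))

  val : BConst → ℤ
  val = evalC I

  inS? : (b : Pos × BConst) → Dec (proj₁ b ∈ S)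
  inS? b = proj₁ b ∈? S

  thresholds : List BConst
  thresholds = map proj₂ (filter inS? (bounds N))

  ∈-thresholds : ∀ {c} → c ∈ thresholds ⇔ (∃[ p ] (p ∈ S × IPos N p c))
  ∈-thresholds = mk⇔
    (λ m → let (p , _) , b∈ , c≡ , p∈ = ∈-map∘filter⁻ proj₂ inS? m
           in p , p∈ , subst (IPos N p) (sym c≡) (∈-bounds .to b∈))
    (λ (p , p∈ , ip) → ∈-map∘filter⁺ proj₂ inS? (_ , ∈-bounds .from ip , refl , p∈))

  open RoundDown val c-∞ thresholds

  roundDown∈𝓘 : ∀ v → I↓var N x (roundDown v)
  roundDown∈𝓘 v with roundDown-sel v
  ... | inj₁ c∞≡ = C , C∈N , px , occ-x , inj₁ c∞≡
  ... | inj₂ (c∈ , _) with p , p∈ , ip ← ∈-thresholds .to c∈ =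
    C , C∈N , px , occ-x , inj₂ (p , All.lookup S⊑px p∈ , ip)

  c∞≤ : ∀ {c} → BConstOccurs N c → c∞v ℤ.≤ val c
  c∞≤ {c} occ with c-∞≟ c
  ... | yes refl = ℤ.≤-refl
  ... | no c∞≢c = ℤ.<⇒≤ (Models-PsiClause I .to (I⊨ _ (inj₂ (inj₂ (c , occ , c∞≢c ∘ sym , refl)))))

  InS : Clause → ℕ → Set
  InS D y = ∃[ p ] (p ∈ S × OccAt D p base y)

  InS? : ∀ D y → Dec (InS D y)
  InS? D y = Dec.map (mk⇔ witness (λ (p , p∈ , occ) → lose (∈-occs D .from occ) (p∈ , refl)))
                     (Any.any? (λ o → (proj₁ o ∈? S) ×-dec (proj₂ o ℕ.≟ y)) (occs D))
    where
      witness : Any (λ o → proj₁ o ∈ S × proj₂ o ≡ y) (occs D) → InS D y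
      witness any with (p , _) , o∈ , p∈ , refl ← find any = p , p∈ , ∈-occs D .to o∈

  InS⇒∈S : ∀ {D p y} → D ∈ N → OccAt D p base y → InS D y → p ∈ S
  InS⇒∈S D∈ occ (_ , p₀∈ , occ₀) =
    S-closed (∈-edges .from (_ , D∈ , _ , _ , occ , occ₀ , inj₁ refl)) p₀∈

  InS-le : ∀ {D y z} → D ∈ N → LeIn (Λ D) y z → BVarInAtoms D y → InS D z → InS D y
  InS-le D∈ y≤z (q , occ-y) (_ , p∈ , occ-z) =
    q , S-closed (∈-edges .from (_ , D∈ , _ , _ , occ-y , occ-z , inj₂ y≤z)) p∈ , occ-y

  threshold-of-InS : ∀ {D y c} → D ∈ N → LowerBoundIn (Λ D) y c → InS D y → c ∈ thresholds
  threshold-of-InS D∈ lb (p , p∈ , occ) = ∈-thresholds .from (p , p∈ , _ , D∈ , _ , occ , lb)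

  -- the assignment under which I evaluates a clause D as J does under β
  simulate : Clause → (ℕ → ℤ) → ℕ → ℤ
  simulate D β y = project (does (InS? D y)) (β y)

  simulate-mono : ∀ {D y z} β → D ∈ N → LeIn (Λ D) y z → BVarInAtoms D y →
                  β y ℤ.≤ β z → simulate D β y ℤ.≤ simulate D β z
  simulate-mono {D} {y} {z} β D∈ y≤z occ-y = project-mono (does-mono (InS? D z) (InS? D y) (InS-le D∈ y≤z occ-y))

  CSat-simulate : ∀ {D k} β → D ∈ N → k ∈ Λ D → CSat I β k → CSat I (simulate D β) k
  CSat-simulate {D} β D∈ k∈ = go _ (All.lookup (nf-constr D D∈) k∈) k∈
    where
      occurs : ∀ {y r c} → vt y r (con c) ∈ Λ D → BConstOccurs N c
      occurs k∈ = D , D∈ , lose k∈ (vt-t here)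

      go : ∀ k → NFConstr k → k ∈ Λ D → CSat I β k → CSat I (simulate D β) k
      go (gnd _ _ _) _ _ h = h
      go (vt y _ _) (inj₁ refl , _ , refl) k∈ h = project≤ (does (InS? D y)) h (c∞≤ (occurs k∈))
      go (vt y _ _) (inj₂ (inj₁ refl) , _ , refl) k∈ h =
        ℤ.≤-antisym (project≤ (does (InS? D y)) (ℤ.≤-reflexive h) (c∞≤ (occurs k∈)))
                    (threshold≤project (InS? D y) (threshold-of-InS D∈ (inj₁ k∈)) (ℤ.≤-reflexive (sym h)))
      go (vt y _ _) (inj₂ (inj₂ refl) , _ , refl) k∈ h =
        threshold≤project (InS? D y) (threshold-of-InS D∈ (inj₂ k∈)) h
      go (vv y _ _) (inj₁ refl) k∈ h = simulate-mono β D∈ (inj₁ k∈) (nf-vars D D∈ y (lose k∈ vv-l)) h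
      go (vv _ _ z) (inj₂ refl) k∈ h = simulate-mono β D∈ (inj₂ k∈) (nf-vars D D∈ z (lose k∈ vv-r)) h

  projectArgs : (ℕ → ℤ → ℤ) → ∀ {ss} → All (Val U) ss → All (Val U) ss
  projectArgs f {[]} [] = []
  projectArgs f {base ∷ _} (v ∷ vs) = f 0 v ∷ projectArgs (f ∘ suc) vs
  projectArgs f {free ∷ _} (u ∷ vs) = u ∷ projectArgs (f ∘ suc) vs

  J : Interp
  J = record I { pr = λ P vs → pr P (projectArgs (λ i → project (does ((P , i) ∈? S))) vs) }

  evalF-J : ∀ γ t → evalF J γ t ≡ evalF I γ t
  evalF-J γ (fvar _) = refl
  evalF-J γ (fcon _) = refl

  projectArgs-eval : ∀ β β′ γ {ss} (args : All ArgOf ss) (f : ℕ → ℤ → ℤ) →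
                     (∀ {i y} → ArgAt args i base y → f i (β y) ≡ β′ y) →
                     projectArgs f (All.map (evalArg J β γ) args) ≡ All.map (evalArg I β′ γ) args
  projectArgs-eval β β′ γ {[]} [] f agree = refl
  projectArgs-eval β β′ γ {base ∷ _} (_ ∷ args) f agree =
    cong₂ _∷_ (agree here) (projectArgs-eval β β′ γ args (f ∘ suc) (agree ∘ there))
  projectArgs-eval β β′ γ {free ∷ _} (t ∷ args) f agree =
    cong₂ _∷_ (evalF-J γ t) (projectArgs-eval β β′ γ args (f ∘ suc) (agree ∘ there))

  ASat-simulate : ∀ {D a} β γ → D ∈ N → a ∈ Atoms D → ASat J β γ a ≡ ASat I (simulate D β) γ a
  ASat-simulate {a = s ≈ₐ t} β γ D∈ a∈ = cong₂ _≡_ (evalF-J γ s) (evalF-J γ t)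
  ASat-simulate {D} {app P args} β γ D∈ a∈ = cong (pr P) (projectArgs-eval β _ γ args _ position-agrees)
    where
      position-agrees : ∀ {i y} → ArgAt args i base y →
                        project (does ((P , i) ∈? S)) (β y) ≡ simulate D β y
      position-agrees {i} {y} at = cong (λ b → project b (β y))
        (Dec.does-⇔ (mk⇔ (λ p∈ → _ , p∈ , occ) (InS⇒∈S D∈ occ)) ((P , i) ∈? S) (InS? D y))
        where occ = args , a∈ , at

  module _ {D} (D∈ : D ∈ N) (β : ℕ → ℤ) (γ : ℕ → U) where

    Λ-simulate : All (CSat J β) (Λ D) → All (CSat I (simulate D β)) (Λ D)
    Λ-simulate Λ⊨ = All.tabulate λ {k} k∈ →
      CSat-simulate β D∈ k∈ (CSat-cong β k (λ c _ → evalC-J c) (All.lookup Λ⊨ k∈))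
      where
        evalC-J : ∀ c → evalC J c ≡ evalC I c
        evalC-J (num _) = refl
        evalC-J (sk _) = refl
        evalC-J c-∞ = refl

    Γ-simulate : All (ASat J β γ) (Γ D) → All (ASat I (simulate D β) γ) (Γ D)
    Γ-simulate Γ⊨ = All.tabulate λ {a} a∈ →
      subst id (ASat-simulate β γ D∈ (∈-++⁺ˡ a∈)) (All.lookup Γ⊨ a∈)

    Δ-simulate : Any (ASat I (simulate D β) γ) (Δ D) → Any (ASat J β γ) (Δ D)
    Δ-simulate Δ⊨ with a , a∈ , sat ← find Δ⊨ =
      lose a∈ (subst id (sym (ASat-simulate β γ D∈ (∈-++⁺ʳ (Γ D) a∈))) sat)

  I⊨⇒J⊨ : ∀ {D} → D ∈ N → Models I D → Models J D
  I⊨⇒J⊨ D∈ I⊨D β γ Λ⊨ Γ⊨ =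
    Δ-simulate D∈ β γ (I⊨D _ γ (Λ-simulate D∈ β γ Λ⊨) (Γ-simulate D∈ β γ Γ⊨))

  J⊨C : Models J C
  J⊨C β γ Λ⊨ Γ⊨ =
    Δ-simulate C∈N β γ (I⊨ (inst C x c) (inj₂ (inj₁ (c , roundDown∈𝓘 (β x) , refl))) _ γ
      (CSat-inst I _ C .from (simulate-x , Λ-simulate C∈N β γ Λ⊨)) (Γ-simulate C∈N β γ Γ⊨))
    where
      c = roundDown (β x)

      simulate-x : simulate C β x ≡ val c
      simulate-x rewrite Dec.dec-true (InS? C x) (px , px∈S , occ-x) = refl

  J⊨N : ∀ D → D ∈ N → Models J D
  J⊨N D D∈ with ≡⊎≢-clause nf C∈N (inj₂ (px , occ-x)) D∈
  ... | inj₁ refl = J⊨C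
  ... | inj₂ D≢C = I⊨⇒J⊨ D∈ (I⊨ D (inj₁ (D∈ , D≢C)))

lemma4 : (N : List Clause) → NormalForm N →
         (BConstOccurs N c-∞ → ∀ D → InPsi N D → D ∈ N) →
         (C : Clause) → C ∈ N → (x : ℕ) → BVarOf C x →
         Satisfiable (λ D → D ∈ N) ⇔ Satisfiable (Nhat N C x)
lemma4 N nf Ψ⊆N C C∈N x x∈C = mk⇔ forward backward
  where
    forward : Satisfiable (_∈ N) → Satisfiable (Nhat N C x)
    forward sat with I , I⊨N , I⊨Ψ ← ∪Ψ-satisfiable N Ψ⊆N sat = I , Nhat-models C∈N I⊨N I⊨Ψ

    occ-x : ∃[ p ] OccAt C p base x
    occ-x = Sum.[ NormalForm.nf-vars nf C C∈N x , id ] x∈C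

    backward : Satisfiable (Nhat N C x) → Satisfiable (_∈ N)
    backward (I , I⊨) = J , J⊨N
      where open Projection N nf C∈N (proj₂ occ-x) I I⊨
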